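{- Let $q=2^m$ with $m\ge 3$ odd, let $E=\mathbb{F}_{q^4}$, let $s=q-\sqrt{2q}+1$, $t=q+\sqrt{2q}+1$, and let $\mathcal{O}_s=\{x\in E\mid x^s=1\}$, $\mathcal{O}_t=\{x\in E\mid x^t=1\}$. Let $x\in\mathcal{O}_s\cup\mathcal{O}_t$ with $x\neq 1$, and put $\lambda=\left(x^{q-1}+\frac{1}{x^{q-1}}\right)^{q-1}$. Then $$x^{q+1}+\sqrt{(\lambda^{\sqrt{2q}}+1)\lambda}\; x+\lambda^{\sqrt{2q}/2}=0,$$ where $\sqrt{y}$ denotes the unique square root of $y$ in $E$.
   Context: Since $m$ is odd, $\sqrt{2q}=2^{(m+1)/2}$ and $\sqrt{2q}/2=2^{(m-1)/2}$ are integers. In characteristic $2$ every element of $E$ has a unique square root. -}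

module Defs where

open import Level using (Level; _⊔_; suc)
open import Data.Nat.Base using (ℕ)
open import Data.Fin.Base using (Fin)
open import Data.Product.Base using (∃)
open import Relation.Nullary.Negation using (¬_)
open import Relation.Binary.PropositionalEquality using (setoid)
open import Algebra.Bundles using (CommutativeRing)
open import Function.Bundles using (Bijection)

record IsField {c ℓ : Level} (R : CommutativeRing c ℓ) : Set (c ⊔ ℓ) where
  open CommutativeRing R
  field
    0≉1     : ¬ (0# ≈ 1#)
    inverse : ∀ x → ¬ (x ≈ 0#) → ∃ λ y → x * y ≈ 1#

record FiniteField (c ℓ : Level) (n : ℕ) : Set (suc (c ⊔ ℓ)) where
  field
    cring    : CommutativeRing c ℓ
    isField  : IsField cring
    card     : Bijection (setoid (Fin n)) (CommutativeRing.setoid cring)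
  open CommutativeRing cring public
  open import Algebra.Properties.Semiring.Exp semiring public using (_^_)

{-# OPTIONS --safe #-}
-- Both s and t divide q² + 1, so x^(q²) = x⁻¹. Put X = x^q, y = x^(q-1) = X/x, w = y + 1/y,
-- P = x² and Y = X². Then λw = w^q, which by the Frobenius gives λ(Y + P) = 1 + YP; raising
-- it to the power σ = √(2q) and using y^σ = x^∓2 on Oₛ resp. Oₜ gives L(P²Y + Y) = Y²P + P
-- for L = λ^σ. Since squaring is additive and r² = (L + 1)λ, the square of the left-hand
-- side is YP + (L + 1)λP + L; times the nonzero P²Y + Y it is a combination of the two
-- relations that vanishes in characteristic 2, and squaring is injective.
module Submission where

open import Defs
open import Level using (Level)
open import Data.Nat.Base using (ℕ; _≤_; _∸_) renaming (_+_ to _+ℕ_; _*_ to _*ℕ_; _^_ to _^ℕ_)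
open import Data.Sum.Base using (_⊎_)
open import Relation.Nullary.Negation using (¬_)

open import Data.Nat.Base using (zero; suc; pred; s≤s)
import Data.Nat.Properties as ℕ
open import Data.Nat.Tactic.RingSolver using (solve-∀)
open import Data.Sum.Base using (inj₁; inj₂)
open import Data.Product.Base using (_,_)
open import Function.Base using (_∘_)
open import Relation.Nullary.Negation using (contradiction)
open import Relation.Nullary.Decidable using (yes; no; via-injection)
open import Relation.Binary.Definitions using (Decidable)
import Relation.Binary.PropositionalEquality as ≡
open ≡ using (_≡_)
open import Algebra.Bundles using (CommutativeRing)
import Algebra.Properties.Semiring.Exp as Exp
open import Function.Properties.Bijection using (Bijection⇒Inverse)
open import Function.Properties.Inverse using (Inverse⇒Injection)
import Function.Construct.Symmetry as Symmetry
import Data.Fin.Properties as Fin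

module CommutativeRingProperties {r ℓ} (R : CommutativeRing r ℓ) where

  open CommutativeRing R
  open Exp semiring using (_^_; ^-congˡ; ^-congʳ; ^-homo-*; ^-assocʳ)
  open import Algebra.Properties.CommutativeSemiring.Exp commutativeSemiring using (^-distrib-*)
  open import Algebra.Solver.Ring.NaturalCoefficients.Default commutativeSemiring
  open import Relation.Binary.Reasoning.Setoid setoid

  1^n≈1 : ∀ n → 1# ^ n ≈ 1#
  1^n≈1 zero    = refl
  1^n≈1 (suc n) = trans (*-identityˡ (1# ^ n)) (1^n≈1 n)

  x^[n∸1]*x≈x^n : ∀ x {n} → 1 ≤ n → x ^ (n ∸ 1) * x ≈ x ^ n
  x^[n∸1]*x≈x^n x (s≤s _) = *-comm _ x

  x^[2*n]≈x^n*x^n : ∀ x n → x ^ (2 *ℕ n) ≈ x ^ n * x ^ n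
  x^[2*n]≈x^n*x^n x n = trans (^-homo-* x n (n +ℕ 0)) (*-congˡ (^-congʳ x (ℕ.+-identityʳ n)))

  [x^m]^n≈[x^n]^m : ∀ x m n → (x ^ m) ^ n ≈ (x ^ n) ^ m
  [x^m]^n≈[x^n]^m x m n =
    trans (^-assocʳ x m n) (trans (^-congʳ x (ℕ.*-comm m n)) (sym (^-assocʳ x n m)))

  x^n≈1⇒x^[m+n*k]≈x^m : ∀ {x} n → x ^ n ≈ 1# → ∀ m k → x ^ (m +ℕ n *ℕ k) ≈ x ^ m
  x^n≈1⇒x^[m+n*k]≈x^m {x} n x^n≈1 m k = begin
    x ^ (m +ℕ n *ℕ k)     ≈⟨ ^-homo-* x m (n *ℕ k) ⟩
    x ^ m * x ^ (n *ℕ k)  ≈⟨ *-congˡ (^-assocʳ x n k) ⟨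
    x ^ m * (x ^ n) ^ k   ≈⟨ *-congˡ (trans (^-congˡ k x^n≈1) (1^n≈1 k)) ⟩
    x ^ m * 1#            ≈⟨ *-identityʳ (x ^ m) ⟩
    x ^ m                 ∎

  x*y≈1⇒x^n*y^n≈1 : ∀ {x y} n → x * y ≈ 1# → x ^ n * y ^ n ≈ 1#
  x*y≈1⇒x^n*y^n≈1 {x} {y} n x*y≈1 =
    trans (sym (^-distrib-* x y n)) (trans (^-congˡ n x*y≈1) (1^n≈1 n))

  inverse-unique : ∀ {x y z} → x * y ≈ 1# → x * z ≈ 1# → y ≈ z
  inverse-unique {x} {y} {z} x*y≈1 x*z≈1 = begin
    y            ≈⟨ *-identityʳ y ⟨
    y * 1#       ≈⟨ *-congˡ x*z≈1 ⟨
    y * (x * z)  ≈⟨ *-assoc y x z ⟨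
    y * x * z    ≈⟨ *-congʳ (trans (*-comm y x) x*y≈1) ⟩
    1# * z       ≈⟨ *-identityˡ z ⟩
    z            ∎

  multiply-through : ∀ {x a b c d m a′ b′ c′ d′} → x * (a + b) ≈ c + d →
                     a * m ≈ a′ → b * m ≈ b′ → c * m ≈ c′ → d * m ≈ d′ →
                     x * (a′ + b′) ≈ c′ + d′
  multiply-through {x} {a} {b} {c} {d} {m} {a′} {b′} {c′} {d′} eq am bm cm dm = begin
    x * (a′ + b′)         ≈⟨ *-congˡ (+-cong am bm) ⟨
    x * (a * m + b * m)   ≈⟨ *-congˡ (distribʳ m a b) ⟨
    x * ((a + b) * m)     ≈⟨ *-assoc x (a + b) m ⟨
    x * (a + b) * m       ≈⟨ *-congʳ eq ⟩
    (c + d) * m           ≈⟨ distribʳ m c d ⟩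
    c * m + d * m         ≈⟨ +-cong cm dm ⟩
    c′ + d′               ∎

  module CharacteristicTwo (1+1≈0 : 1# + 1# ≈ 0#) where

    x+x≈0 : ∀ x → x + x ≈ 0#
    x+x≈0 x = begin
      x + x            ≈⟨ +-cong (*-identityˡ x) (*-identityˡ x) ⟨
      1# * x + 1# * x  ≈⟨ distribʳ x 1# 1# ⟨
      (1# + 1#) * x    ≈⟨ *-congʳ 1+1≈0 ⟩
      0# * x           ≈⟨ zeroˡ x ⟩
      0#               ∎

    x+1≈0⇒x≈1 : ∀ {x} → x + 1# ≈ 0# → x ≈ 1#
    x+1≈0⇒x≈1 {x} x+1≈0 = begin
      x              ≈⟨ +-identityʳ x ⟨
      x + 0#         ≈⟨ +-congˡ 1+1≈0 ⟨
      x + (1# + 1#)  ≈⟨ +-assoc x 1# 1# ⟨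
      x + 1# + 1#    ≈⟨ +-congʳ x+1≈0 ⟩
      0# + 1#        ≈⟨ +-identityˡ 1# ⟩
      1#             ∎

    [x+y]²≈x²+y² : ∀ x y → (x + y) * (x + y) ≈ x * x + y * y
    [x+y]²≈x²+y² x y = begin
      (x + y) * (x + y)                ≈⟨ solve 2 (λ x y → (x :+ y) :* (x :+ y) :=
                                            (x :* x :+ y :* y) :+ (x :* y :+ x :* y)) refl x y ⟩
      x * x + y * y + (x * y + x * y)  ≈⟨ +-congˡ (x+x≈0 (x * y)) ⟩
      x * x + y * y + 0#               ≈⟨ +-identityʳ _ ⟩
      x * x + y * y                    ∎

    [x+y+z]²≈x²+y²+z² : ∀ x y z → (x + y + z) * (x + y + z) ≈ x * x + y * y + z * z
    [x+y+z]²≈x²+y²+z² x y z = trans ([x+y]²≈x²+y² (x + y) z) (+-congʳ ([x+y]²≈x²+y² x y))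

    frobenius : ∀ n x y → (x + y) ^ (2 ^ℕ n) ≈ x ^ (2 ^ℕ n) + y ^ (2 ^ℕ n)
    frobenius zero    x y = trans (*-identityʳ (x + y)) (sym (+-cong (*-identityʳ x) (*-identityʳ y)))
    frobenius (suc n) x y = begin
      (x + y) ^ (2 *ℕ N)                 ≈⟨ x^[2*n]≈x^n*x^n (x + y) N ⟩
      (x + y) ^ N * (x + y) ^ N          ≈⟨ *-cong (frobenius n x y) (frobenius n x y) ⟩
      (x ^ N + y ^ N) * (x ^ N + y ^ N)  ≈⟨ [x+y]²≈x²+y² (x ^ N) (y ^ N) ⟩
      x ^ N * x ^ N + y ^ N * y ^ N      ≈⟨ +-cong (x^[2*n]≈x^n*x^n x N) (x^[2*n]≈x^n*x^n y N) ⟨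
      x ^ (2 *ℕ N) + y ^ (2 *ℕ N)        ∎
      where
        N : ℕ
        N = 2 ^ℕ n

    squared-equation≈0 : ∀ {P Y lam L} →
                         lam * (Y + P) ≈ 1# + Y * P →
                         L * (P * P * Y + Y) ≈ Y * Y * P + P →
                         (Y * P + (L + 1#) * lam * P + L) * (P * P * Y + Y) ≈ 0#
    squared-equation≈0 {P} {Y} {lam} {L} lam-relation L-relation = begin
      (Y * P + (L + 1#) * lam * P + L) * (P * P * Y + Y)
        ≈⟨ solve 4 (λ P Y lam L →
             (Y :* P :+ (L :+ con 1) :* lam :* P :+ L) :* (P :* P :* Y :+ Y) :=
             Y :* P :* (P :* P :* Y :+ Y) :+ L :* (P :* P :* Y :+ Y) :* (lam :* P :+ con 1)
               :+ (P :* P :* Y :+ Y) :* lam :* P) refl P Y lam L ⟩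
      Y * P * (P * P * Y + Y) + L * (P * P * Y + Y) * (lam * P + 1#) + (P * P * Y + Y) * lam * P
        ≈⟨ +-congʳ (+-congˡ (*-congʳ L-relation)) ⟩
      Y * P * (P * P * Y + Y) + (Y * Y * P + P) * (lam * P + 1#) + (P * P * Y + Y) * lam * P
        ≈⟨ solve 3 (λ P Y lam →
             Y :* P :* (P :* P :* Y :+ Y) :+ (Y :* Y :* P :+ P) :* (lam :* P :+ con 1)
               :+ (P :* P :* Y :+ Y) :* lam :* P :=
             Y :* P :* (P :* P :* Y :+ Y) :+ (Y :* Y :* P :+ P)
               :+ P :* (con 1 :+ Y :* P) :* (lam :* (Y :+ P))) refl P Y lam ⟩
      Y * P * (P * P * Y + Y) + (Y * Y * P + P) + P * (1# + Y * P) * (lam * (Y + P))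
        ≈⟨ +-congˡ (*-congˡ lam-relation) ⟩
      Y * P * (P * P * Y + Y) + (Y * Y * P + P) + P * (1# + Y * P) * (1# + Y * P)
        ≈⟨ solve 2 (λ P Y →
             Y :* P :* (P :* P :* Y :+ Y) :+ (Y :* Y :* P :+ P) :+ P :* (con 1 :+ Y :* P) :* (con 1 :+ Y :* P) :=
             (Y :* Y :* P :* P :* P :+ Y :* Y :* P :+ Y :* P :* P :+ P)
               :+ (Y :* Y :* P :* P :* P :+ Y :* Y :* P :+ Y :* P :* P :+ P)) refl P Y ⟩
      Z + Z
        ≈⟨ x+x≈0 Z ⟩
      0# ∎
      where
        Z : Carrier
        Z = Y * Y * P * P * P + Y * Y * P + Y * P * P + P

module FieldProperties {r ℓ} (R : CommutativeRing r ℓ) (isField : IsField R) where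

  open CommutativeRing R
  open IsField isField
  open Exp semiring using (_^_)
  open import Algebra.Properties.Monoid *-monoid using (cancelˡ)
  open CommutativeRingProperties R using (module CharacteristicTwo)

  x≉0⇒x*y≈0⇒y≈0 : ∀ {x y} → ¬ x ≈ 0# → x * y ≈ 0# → y ≈ 0#
  x≉0⇒x*y≈0⇒y≈0 {x} {y} x≉0 x*y≈0 with inverse x x≉0
  ... | x⁻¹ , x*x⁻¹≈1 =
    trans (sym (cancelˡ (trans (*-comm x⁻¹ x) x*x⁻¹≈1) y)) (trans (*-congˡ x*y≈0) (zeroʳ x⁻¹))

  x≉0∧y≉0⇒x*y≉0 : ∀ {x y} → ¬ x ≈ 0# → ¬ y ≈ 0# → ¬ x * y ≈ 0#
  x≉0∧y≉0⇒x*y≉0 x≉0 y≉0 = y≉0 ∘ x≉0⇒x*y≈0⇒y≈0 x≉0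

  x≉0⇒x^n≉0 : ∀ {x} → ¬ x ≈ 0# → ∀ n → ¬ x ^ n ≈ 0#
  x≉0⇒x^n≉0 x≉0 zero    = 0≉1 ∘ sym
  x≉0⇒x^n≉0 x≉0 (suc n) = x≉0∧y≉0⇒x*y≉0 x≉0 (x≉0⇒x^n≉0 x≉0 n)

  module _ (_≟_ : Decidable _≈_) where

    x*x≈0⇒x≈0 : ∀ {x} → x * x ≈ 0# → x ≈ 0#
    x*x≈0⇒x≈0 {x} x*x≈0 with x ≟ 0#
    ... | yes x≈0 = x≈0
    ... | no  x≉0 = contradiction x*x≈0 (x≉0∧y≉0⇒x*y≉0 x≉0 x≉0)

    x*x+1≈0⇒x≈1 : 1# + 1# ≈ 0# → ∀ {x} → x * x + 1# ≈ 0# → x ≈ 1#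
    x*x+1≈0⇒x≈1 1+1≈0 {x} x*x+1≈0 = x+1≈0⇒x≈1 (x*x≈0⇒x≈0
      (trans ([x+y]²≈x²+y² x 1#) (trans (+-congˡ (*-identityʳ 1#)) x*x+1≈0)))
      where open CharacteristicTwo 1+1≈0

module _ {r ℓ} (R : CommutativeRing r ℓ) where

  open CommutativeRing R
  open Exp semiring using (_^_)

  module RootIdentity
      (isField : IsField R) (_≟_ : Decidable _≈_) (1+1≈0 : 1# + 1# ≈ 0#)
      {q σ e : ℕ} (1≤q : 1 ≤ q) (σ≡2*e : σ ≡ 2 *ℕ e)
      (q-additive : ∀ a b → (a + b) ^ q ≈ a ^ q + b ^ q)
      (σ-additive : ∀ a b → (a + b) ^ σ ≈ a ^ σ + b ^ σ)
      (x u : Carrier) (x^[1+q*q]≈1 : x ^ (1 +ℕ q *ℕ q) ≈ 1#) (u*y≈1 : u * x ^ (q ∸ 1) ≈ 1#)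
      where

    open CommutativeRingProperties R
    open CharacteristicTwo 1+1≈0
    open FieldProperties R isField
    open IsField isField using (0≉1)
    open Exp semiring hiding (_^_)
    open import Algebra.Properties.CommutativeSemiring.Exp commutativeSemiring using (^-distrib-*)
    open import Algebra.Properties.CommutativeSemigroup *-commutativeSemigroup
      using (interchange; x∙yz≈xz∙y; x∙yz≈y∙xz)
    open import Algebra.Properties.Monoid *-monoid using (cancelˡ)
    open import Relation.Binary.Reasoning.Setoid setoid

    X y w lam L P Y : Carrier
    X   = x ^ q
    y   = x ^ (q ∸ 1)
    w   = y + u
    lam = w ^ (q ∸ 1)
    L   = lam ^ σ
    P   = x * x
    Y   = X * X

    x≉0 : ¬ x ≈ 0#
    x≉0 x≈0 = 0≉1 (begin
      0#                 ≈⟨ zeroˡ (x ^ (q *ℕ q)) ⟨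
      0# * x ^ (q *ℕ q)  ≈⟨ *-congʳ x≈0 ⟨
      x ^ (1 +ℕ q *ℕ q)  ≈⟨ x^[1+q*q]≈1 ⟩
      1#                 ∎)

    y*x≈X : y * x ≈ X
    y*x≈X = x^[n∸1]*x≈x^n x 1≤q

    u*X≈x : u * X ≈ x
    u*X≈x = trans (*-congˡ (sym y*x≈X)) (cancelˡ u*y≈1 x)

    y^n*u^n≈1 : ∀ n → y ^ n * u ^ n ≈ 1#
    y^n*u^n≈1 n = x*y≈1⇒x^n*y^n≈1 n (trans (*-comm y u) u*y≈1)

    y^q*[X*x]≈1 : y ^ q * (X * x) ≈ 1#
    y^q*[X*x]≈1 = begin
      y ^ q * (X * x)    ≈⟨ *-assoc (y ^ q) X x ⟨
      y ^ q * x ^ q * x  ≈⟨ *-congʳ (^-distrib-* y x q) ⟨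
      (y * x) ^ q * x    ≈⟨ *-congʳ (^-congˡ q y*x≈X) ⟩
      X ^ q * x          ≈⟨ *-congʳ (^-assocʳ x q q) ⟩
      x ^ (q *ℕ q) * x   ≈⟨ *-comm _ x ⟩
      x ^ (1 +ℕ q *ℕ q)  ≈⟨ x^[1+q*q]≈1 ⟩
      1#                 ∎

    u^q≈X*x : u ^ q ≈ X * x
    u^q≈X*x = inverse-unique (y^n*u^n≈1 q) y^q*[X*x]≈1

    lam*w≈w^q : lam * w ≈ w ^ q
    lam*w≈w^q = x^[n∸1]*x≈x^n w 1≤q

    lam-relation : lam * (Y + P) ≈ 1# + Y * P
    lam-relation = multiply-through (trans lam*w≈w^q (q-additive y u))
      (trans (x∙yz≈xz∙y y X x) (*-congʳ y*x≈X))
      (trans (sym (*-assoc u X x)) (*-congʳ u*X≈x))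
      y^q*[X*x]≈1
      (trans (*-congʳ u^q≈X*x) (interchange X x X x))

    L*w^σ≈[w^σ]^q : L * w ^ σ ≈ (w ^ σ) ^ q
    L*w^σ≈[w^σ]^q = begin
      L * w ^ σ      ≈⟨ ^-distrib-* lam w σ ⟨
      (lam * w) ^ σ  ≈⟨ ^-congˡ σ lam*w≈w^q ⟩
      (w ^ q) ^ σ    ≈⟨ [x^m]^n≈[x^n]^m w q σ ⟩
      (w ^ σ) ^ q    ∎

    P^q≈Y : P ^ q ≈ Y
    P^q≈Y = ^-distrib-* x x q

    L-relation-from : ∀ {P′} → P′ * P ≈ 1# → w ^ σ ≈ P + P′ → L * (P * P * Y + Y) ≈ Y * Y * P + P
    L-relation-from {P′} P′*P≈1 w^σ≈P+P′ = multiply-through L*[P+P′]≈Y+P′^q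
      (sym (*-assoc P P Y))
      (cancelˡ P′*P≈1 Y)
      (x∙yz≈xz∙y Y P Y)
      (trans (x∙yz≈y∙xz (P′ ^ q) P Y) (trans (*-congˡ P′^q*Y≈1) (*-identityʳ P)))
      where
        L*[P+P′]≈Y+P′^q : L * (P + P′) ≈ Y + P′ ^ q
        L*[P+P′]≈Y+P′^q = begin
          L * (P + P′)    ≈⟨ *-congˡ w^σ≈P+P′ ⟨
          L * w ^ σ       ≈⟨ L*w^σ≈[w^σ]^q ⟩
          (w ^ σ) ^ q     ≈⟨ ^-congˡ q w^σ≈P+P′ ⟩
          (P + P′) ^ q    ≈⟨ q-additive P P′ ⟩
          P ^ q + P′ ^ q  ≈⟨ +-congʳ P^q≈Y ⟩
          Y + P′ ^ q      ∎
        P′^q*Y≈1 : P′ ^ q * Y ≈ 1#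
        P′^q*Y≈1 = trans (*-congˡ (sym P^q≈Y)) (x*y≈1⇒x^n*y^n≈1 q P′*P≈1)

    x^2≈P : x ^ 2 ≈ P
    x^2≈P = *-congˡ (*-identityʳ x)

    L-relation : y ^ σ * x ^ 2 ≈ 1# ⊎ y ^ σ ≈ x ^ 2 → L * (P * P * Y + Y) ≈ Y * Y * P + P
    L-relation (inj₁ y^σ*x²≈1) = L-relation-from y^σ*P≈1
      (trans (σ-additive y u) (trans (+-comm (y ^ σ) (u ^ σ)) (+-congʳ u^σ≈P)))
      where
        y^σ*P≈1 : y ^ σ * P ≈ 1#
        y^σ*P≈1 = trans (*-congˡ (sym x^2≈P)) y^σ*x²≈1
        u^σ≈P : u ^ σ ≈ P
        u^σ≈P = inverse-unique (y^n*u^n≈1 σ) y^σ*P≈1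
    L-relation (inj₂ y^σ≈x²) = L-relation-from
      (trans (*-congˡ (sym y^σ≈P)) (trans (*-comm (u ^ σ) (y ^ σ)) (y^n*u^n≈1 σ)))
      (trans (σ-additive y u) (+-congʳ y^σ≈P))
      where
        y^σ≈P : y ^ σ ≈ P
        y^σ≈P = trans y^σ≈x² x^2≈P

    root-identity : ¬ x ≈ 1# → y ^ σ * x ^ 2 ≈ 1# ⊎ y ^ σ ≈ x ^ 2 →
                    ∀ r → r * r ≈ (L + 1#) * lam → x ^ (q +ℕ 1) + r * x + lam ^ e ≈ 0#
    root-identity x≉1 y^σ≈x^∓2 r r*r≈[L+1]lam = x*x≈0⇒x≈0 _≟_ (begin
      (x ^ (q +ℕ 1) + r * x + lam ^ e) * (x ^ (q +ℕ 1) + r * x + lam ^ e)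
        ≈⟨ [x+y+z]²≈x²+y²+z² (x ^ (q +ℕ 1)) (r * x) (lam ^ e) ⟩
      x ^ (q +ℕ 1) * x ^ (q +ℕ 1) + r * x * (r * x) + lam ^ e * lam ^ e
        ≈⟨ +-cong (+-cong x^[q+1]²≈Y*P (trans (interchange r x r x) (*-congʳ r*r≈[L+1]lam))) lam^e²≈L ⟩
      Y * P + (L + 1#) * lam * P + L
        ≈⟨ x≉0⇒x*y≈0⇒y≈0 P*P*Y+Y≉0
             (trans (*-comm _ _) (squared-equation≈0 lam-relation (L-relation y^σ≈x^∓2))) ⟩
      0# ∎)
      where
        x^[q+1]≈X*x : x ^ (q +ℕ 1) ≈ X * x
        x^[q+1]≈X*x = trans (^-homo-* x q 1) (*-congˡ (*-identityʳ x))
        x^[q+1]²≈Y*P : x ^ (q +ℕ 1) * x ^ (q +ℕ 1) ≈ Y * P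
        x^[q+1]²≈Y*P = trans (*-cong x^[q+1]≈X*x x^[q+1]≈X*x) (interchange X x X x)
        lam^e²≈L : lam ^ e * lam ^ e ≈ L
        lam^e²≈L = trans (sym (x^[2*n]≈x^n*x^n lam e)) (^-congʳ lam (≡.sym σ≡2*e))
        P≉1 : ¬ P ≈ 1#
        P≉1 P≈1 = x≉1 (x*x+1≈0⇒x≈1 _≟_ 1+1≈0 (trans (+-congʳ P≈1) 1+1≈0))
        P*P*Y+Y≉0 : ¬ P * P * Y + Y ≈ 0#
        P*P*Y+Y≉0 = x≉0∧y≉0⇒x*y≉0 (P≉1 ∘ x*x+1≈0⇒x≈1 _≟_ 1+1≈0) Y≉0
                  ∘ trans (trans (distribʳ Y (P * P) 1#) (+-congˡ (*-identityˡ Y)))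
          where
            Y≉0 : ¬ Y ≈ 0#
            Y≉0 = x≉0∧y≉0⇒x*y≉0 (x≉0⇒x^n≉0 x≉0 q) (x≉0⇒x^n≉0 x≉0 q)

module Exponents (k : ℕ) where

  q σ s t : ℕ
  q = 2 ^ℕ (2 *ℕ k +ℕ 1)
  σ = 2 ^ℕ (k +ℕ 1)
  s = (q ∸ σ) +ℕ 1
  t = q +ℕ σ +ℕ 1

  σ≡2*2^k : σ ≡ 2 *ℕ 2 ^ℕ k
  σ≡2*2^k = ≡.trans (ℕ.^-distribˡ-+-* 2 k 1) (ℕ.*-comm (2 ^ℕ k) 2)

  q≡2^k*σ : q ≡ 2 ^ℕ k *ℕ σ
  q≡2^k*σ = ≡.trans (≡.cong (2 ^ℕ_) (e k)) (ℕ.^-distribˡ-+-* 2 k (k +ℕ 1))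
    where e : ∀ k → 2 *ℕ k +ℕ 1 ≡ k +ℕ (k +ℕ 1)
          e = solve-∀

  -- Writing 2^k = 1 + f removes every truncated subtraction.
  private
    f : ℕ
    f = pred (2 ^ℕ k)

    2^k≡1+f : 2 ^ℕ k ≡ suc f
    2^k≡1+f = ≡.sym (ℕ.suc-pred (2 ^ℕ k) {{ℕ.m^n≢0 2 k}})

    σ≡ : σ ≡ 2 +ℕ 2 *ℕ f
    σ≡ = ≡.trans σ≡2*2^k (≡.trans (≡.cong (2 *ℕ_) 2^k≡1+f) (e f))
      where e : ∀ f → 2 *ℕ suc f ≡ 2 +ℕ 2 *ℕ f
            e = solve-∀

    q≡ : q ≡ (2 +ℕ 2 *ℕ f) +ℕ 2 *ℕ f *ℕ suc f
    q≡ = ≡.trans q≡2^k*σ (≡.trans (≡.cong₂ _*ℕ_ 2^k≡1+f σ≡) (e f))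
      where e : ∀ f → suc f *ℕ (2 +ℕ 2 *ℕ f) ≡ (2 +ℕ 2 *ℕ f) +ℕ 2 *ℕ f *ℕ suc f
            e = solve-∀

    q∸1≡ : q ∸ 1 ≡ (1 +ℕ 2 *ℕ f) +ℕ 2 *ℕ f *ℕ suc f
    q∸1≡ = ≡.cong (_∸ 1) q≡

    s≡ : s ≡ 2 *ℕ f *ℕ suc f +ℕ 1
    s≡ = ≡.cong (_+ℕ 1) (≡.trans (≡.cong (_∸ σ) (≡.trans q≡ (≡.cong (_+ℕ 2 *ℕ f *ℕ suc f) (≡.sym σ≡))))
                                 (ℕ.m+n∸m≡n σ _))

    t≡ : t ≡ (2 +ℕ 2 *ℕ f) +ℕ 2 *ℕ f *ℕ suc f +ℕ (2 +ℕ 2 *ℕ f) +ℕ 1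
    t≡ = ≡.cong₂ (λ a b → a +ℕ b +ℕ 1) q≡ σ≡

  s*t≡1+q*q : s *ℕ t ≡ 1 +ℕ q *ℕ q
  s*t≡1+q*q = ≡.trans (≡.cong₂ _*ℕ_ s≡ t≡) (≡.trans (e f) (≡.cong (λ n → 1 +ℕ n *ℕ n) (≡.sym q≡)))
    where e : ∀ f → (2 *ℕ f *ℕ suc f +ℕ 1) *ℕ ((2 +ℕ 2 *ℕ f) +ℕ 2 *ℕ f *ℕ suc f +ℕ (2 +ℕ 2 *ℕ f) +ℕ 1)
                  ≡ 1 +ℕ ((2 +ℕ 2 *ℕ f) +ℕ 2 *ℕ f *ℕ suc f) *ℕ ((2 +ℕ 2 *ℕ f) +ℕ 2 *ℕ f *ℕ suc f)
          e = solve-∀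

  [q∸1]*σ+2≡s*[σ+2] : (q ∸ 1) *ℕ σ +ℕ 2 ≡ s *ℕ (σ +ℕ 2)
  [q∸1]*σ+2≡s*[σ+2] = ≡.trans (≡.cong₂ (λ a b → a *ℕ b +ℕ 2) q∸1≡ σ≡)
                        (≡.trans (e f) (≡.sym (≡.cong₂ (λ a b → a *ℕ (b +ℕ 2)) s≡ σ≡)))
    where e : ∀ f → ((1 +ℕ 2 *ℕ f) +ℕ 2 *ℕ f *ℕ suc f) *ℕ (2 +ℕ 2 *ℕ f) +ℕ 2
                  ≡ (2 *ℕ f *ℕ suc f +ℕ 1) *ℕ ((2 +ℕ 2 *ℕ f) +ℕ 2)
          e = solve-∀

  [q∸1]*σ≡2+t*[σ∸2] : (q ∸ 1) *ℕ σ ≡ 2 +ℕ t *ℕ (σ ∸ 2)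
  [q∸1]*σ≡2+t*[σ∸2] = ≡.trans (≡.cong₂ _*ℕ_ q∸1≡ σ≡)
                        (≡.trans (e f) (≡.sym (≡.cong₂ (λ a b → 2 +ℕ a *ℕ (b ∸ 2)) t≡ σ≡)))
    where e : ∀ f → ((1 +ℕ 2 *ℕ f) +ℕ 2 *ℕ f *ℕ suc f) *ℕ (2 +ℕ 2 *ℕ f)
                  ≡ 2 +ℕ ((2 +ℕ 2 *ℕ f) +ℕ 2 *ℕ f *ℕ suc f +ℕ (2 +ℕ 2 *ℕ f) +ℕ 1) *ℕ (2 *ℕ f)
          e = solve-∀

module Orbits {r ℓ} (R : CommutativeRing r ℓ) (k : ℕ) where

  open CommutativeRing R
  open Exp semiring using (_^_; ^-congʳ; ^-homo-*; ^-assocʳ)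
  open CommutativeRingProperties R using (x^n≈1⇒x^[m+n*k]≈x^m)
  open Exponents k
  open import Relation.Binary.Reasoning.Setoid setoid

  Oₛ∪Oₜ⇒x^[1+q*q]≈1 : ∀ {x} → x ^ s ≈ 1# ⊎ x ^ t ≈ 1# → x ^ (1 +ℕ q *ℕ q) ≈ 1#
  Oₛ∪Oₜ⇒x^[1+q*q]≈1 {x} (inj₁ x^s≈1) =
    trans (^-congʳ x (≡.sym s*t≡1+q*q)) (x^n≈1⇒x^[m+n*k]≈x^m s x^s≈1 0 t)
  Oₛ∪Oₜ⇒x^[1+q*q]≈1 {x} (inj₂ x^t≈1) =
    trans (^-congʳ x (≡.trans (≡.sym s*t≡1+q*q) (ℕ.*-comm s t))) (x^n≈1⇒x^[m+n*k]≈x^m t x^t≈1 0 s)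

  Oₛ∪Oₜ⇒[x^[q∸1]]^σ≈x^∓2 : ∀ {x} → x ^ s ≈ 1# ⊎ x ^ t ≈ 1# →
                           (x ^ (q ∸ 1)) ^ σ * x ^ 2 ≈ 1# ⊎ (x ^ (q ∸ 1)) ^ σ ≈ x ^ 2
  Oₛ∪Oₜ⇒[x^[q∸1]]^σ≈x^∓2 {x} (inj₁ x^s≈1) = inj₁ (begin
    (x ^ (q ∸ 1)) ^ σ * x ^ 2   ≈⟨ *-congʳ (^-assocʳ x (q ∸ 1) σ) ⟩
    x ^ ((q ∸ 1) *ℕ σ) * x ^ 2  ≈⟨ ^-homo-* x ((q ∸ 1) *ℕ σ) 2 ⟨
    x ^ ((q ∸ 1) *ℕ σ +ℕ 2)     ≈⟨ ^-congʳ x [q∸1]*σ+2≡s*[σ+2] ⟩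
    x ^ (s *ℕ (σ +ℕ 2))         ≈⟨ x^n≈1⇒x^[m+n*k]≈x^m s x^s≈1 0 (σ +ℕ 2) ⟩
    1#                          ∎)
  Oₛ∪Oₜ⇒[x^[q∸1]]^σ≈x^∓2 {x} (inj₂ x^t≈1) = inj₂
    (trans (^-assocʳ x (q ∸ 1) σ)
      (trans (^-congʳ x [q∸1]*σ≡2+t*[σ∸2]) (x^n≈1⇒x^[m+n*k]≈x^m t x^t≈1 2 (σ ∸ 2))))

≈-decidable : ∀ {r ℓ n} (E : FiniteField r ℓ n) → Decidable (FiniteField._≈_ E)
≈-decidable E =
  via-injection (Inverse⇒Injection (Symmetry.inverse (Bijection⇒Inverse (FiniteField.card E)))) Fin._≟_

lemma4p2 : {c ℓ : Level} (k : ℕ) → 1 ≤ k →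
    let m = 2 *ℕ k +ℕ 1
        q = 2 ^ℕ m
        sq = 2 ^ℕ (k +ℕ 1)
        s = (q ∸ sq) +ℕ 1
        t = q +ℕ sq +ℕ 1
    in (E : FiniteField c ℓ (q ^ℕ 4)) →
    let open FiniteField E in
    1# + 1# ≈ 0# →
    ∀ (x : Carrier) → (x ^ s ≈ 1# ⊎ x ^ t ≈ 1#) → ¬ (x ≈ 1#) →
    ∀ (u : Carrier) → u * x ^ (q ∸ 1) ≈ 1# →
    let lam = (x ^ (q ∸ 1) + u) ^ (q ∸ 1) in
    ∀ (r : Carrier) → r * r ≈ (lam ^ sq + 1#) * lam →
    x ^ (q +ℕ 1) + r * x + lam ^ (2 ^ℕ k) ≈ 0#
lemma4p2 k _ E 1+1≈0 x x∈Oₛ∪Oₜ x≉1 u u*y≈1 =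
  root-identity x≉1 (Oₛ∪Oₜ⇒[x^[q∸1]]^σ≈x^∓2 x∈Oₛ∪Oₜ)
  where
    open FiniteField E using (cring; isField)
    open Exponents k using (σ≡2*2^k)
    open Orbits cring k
    open CommutativeRingProperties.CharacteristicTwo cring 1+1≈0 using (frobenius)
    open RootIdentity cring isField (≈-decidable E) 1+1≈0 {e = 2 ^ℕ k}
           (ℕ.m^n>0 2 (2 *ℕ k +ℕ 1)) σ≡2*2^k (frobenius (2 *ℕ k +ℕ 1)) (frobenius (k +ℕ 1)) x u (Oₛ∪Oₜ⇒x^[1+q*q]≈1 x∈Oₛ∪Oₜ) u*y≈1
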